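{- Let $A$ be a list of $r$-coordinates sorted under a complete ordering $\tau$, and let $\sigma$ be a complete ordering. Suppose that for some index $i$ we have $f(\sigma,\sigma_i)\not\subseteq f(\tau,\sigma_i)$. Consider any finite sequence of statements of the form $$A\gets\textsc{PartialSort}(A,(\psi_1,\ldots,\psi_l),\psi_k),$$ where $\psi$ is the complete ordering under which $A$ is sorted before that statement (starting with $\psi=\tau$ and, after each statement, replacing $\psi$ by $(\psi_1,\ldots,\psi_l,\psi_k,\psi_{l+1},\ldots,\psi_{k-1},\psi_{k+1},\ldots,\psi_r)$), $k>l\ge 0$, and $\psi_k\neq\sigma_i$ in every statement. Then no such sequence results in a $\sigma$ ordering of $A$ (i.e. the final ordering $\psi$ is never $\sigma$). Consequently, any such sequence of $\textsc{PartialSort}$ calls that produces a $\sigma$ ordering of $A$ must include, for each mode $\sigma_i$ with $f(\sigma,\sigma_i)\not\subseteq f(\tau,\sigma_i)$, a call whose sorted mode $\psi_k$ equals $\sigma_i$.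
   Context: An $r$-coordinate is a tuple $(i_1,\ldots,i_r)$ of integers with $1\le i_m\le n_m$; position $m$ is mode $m$. A complete ordering is a tuple of all $r$ modes in some order (a permutation of $(1,\ldots,r)$). Coordinates are compared lexicographically under an ordering $\sigma$: $i<i'$ if $i_{\sigma_1}<i'_{\sigma_1}$, or $i_{\sigma_1}=i'_{\sigma_1}$ and $i<i'$ under $(\sigma_2,\ldots)$; all tuples are equal under $()$. A list is sorted under $\sigma$ if nondecreasing in this order. For $A$ sorted under a complete ordering $\psi$ and $0\le l<k\le r$, $\textsc{PartialSort}(A,(\psi_1,\ldots,\psi_l),\psi_k)$ returns the coordinates of $A$ rearranged to be sorted under $(\psi_1,\ldots,\psi_l,\psi_k,\psi_{l+1},\ldots,\psi_{k-1},\psi_{k+1},\ldots,\psi_r)$. For a complete ordering $\tau$ and mode $p=\tau_k$, $f(\tau,p)=\{\tau_{k+1},\ldots,\tau_r\}$ is the set of modes following $p$ in $\tau$. -}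

module Defs where

open import Data.Nat using (ℕ; suc; _<_; _≤_; _∸_)
open import Data.Fin using (Fin; toℕ)
open import Data.List using (List; []; _∷_; _++_; take; drop; length; lookup; allFin)
open import Data.List.Membership.Propositional using (_∈_)
open import Data.List.Relation.Binary.Permutation.Propositional using (_↭_)
open import Data.List.Relation.Unary.Linked using (Linked)
open import Data.Product using (Σ; _×_)
open import Data.Sum using (_⊎_)
open import Data.Unit using (⊤)
open import Relation.Binary.PropositionalEquality using (_≡_)

-- Modes are Fin r (0-based: mode m+1 of the paper is Fin value m).
-- An r-coordinate with mode sizes n : Fin r → ℕ.
Coord : {r : ℕ} → (Fin r → ℕ) → Set
Coord {r} n = (m : Fin r) → Fin (n m)

Ordering : ℕ → Set
Ordering r = List (Fin r)

Complete : {r : ℕ} → Ordering r → Set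
Complete {r} σ = σ ↭ allFin r

LexLe : {r : ℕ} {n : Fin r → ℕ} → Ordering r → Coord n → Coord n → Set
LexLe []      a b = ⊤
LexLe (m ∷ σ) a b = (toℕ (a m) < toℕ (b m)) ⊎ ((a m ≡ b m) × LexLe σ a b)

Sorted : {r : ℕ} (n : Fin r → ℕ) → Ordering r → List (Coord n) → Set
Sorted n σ A = Linked (LexLe {n = n} σ) A

f : {r : ℕ} → Ordering r → Fin r → Fin r → Set
f {r} τ p q = Σ (Ordering r) λ xs → Σ (Ordering r) λ ys → (τ ≡ xs ++ p ∷ ys) × (q ∈ ys)

-- New ordering after PartialSort(A,(ψ_1..ψ_l),ψ_k), with j = k-1 (0-based index of ψ_k):
-- (ψ_1..ψ_l, ψ_k, ψ_{l+1}..ψ_{k-1}, ψ_{k+1}..ψ_r).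
reorder : {r : ℕ} → (ψ : Ordering r) → ℕ → Fin (length ψ) → Ordering r
reorder ψ l j = take l ψ ++ (lookup ψ j ∷ (take (toℕ j ∸ l) (drop l ψ) ++ drop (suc (toℕ j)) ψ))

-- One statement A ← PartialSort(A,(ψ_1..ψ_l),ψ_k) with 0 ≤ l < k ≤ |ψ|,
-- taking ordering ψ to ψ', with sorted mode p = ψ_k.
data Step {r : ℕ} (ψ : Ordering r) : Fin r → Ordering r → Set where
  partialSort : (l : ℕ) (j : Fin (length ψ)) → l ≤ toℕ j →
                Step ψ (lookup ψ j) (reorder ψ l j)

data Seq {r : ℕ} : Ordering r → Ordering r → List (Fin r) → Set where
  done : ∀ {ψ} → Seq ψ ψ []
  step : ∀ {ψ ψ' ψ'' p ps} → Step ψ p ψ' → Seq ψ' ψ'' ps → Seq ψ ψ'' (p ∷ ps)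

module Submission where

open import Defs
open import Data.Nat using (ℕ; zero; suc; _≤_; _∸_; z≤n; s≤s)
open import Data.Fin using (Fin; toℕ; _≟_) renaming (zero to fzero; suc to fsuc)
open import Data.List using (List; []; _∷_; _++_; take; drop; length; lookup)
open import Data.List.Membership.Propositional using (_∈_)
open import Data.List.Relation.Unary.Any using (here; there; any?)
open import Data.List.Relation.Unary.All using (All; []; _∷_)
import Data.List.Relation.Unary.All as All
open import Data.List.Relation.Unary.All.Properties using (¬Any⇒All¬)
open import Data.List.Relation.Binary.Permutation.Propositional using (↭-sym)
open import Data.List.Relation.Binary.Permutation.Propositional.Properties using (∈-resp-↭; ++⁺ˡ; shift)
open import Data.Empty using (⊥-elim)
open import Data.Product using (_×_; _,_)
open import Relation.Nullary using (¬_; yes; no)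
open import Relation.Unary using (_⊆_)
open import Relation.Binary.PropositionalEquality using (_≡_; _≢_; refl; sym; cong; subst; ≢-sym)

-- A PartialSort step moves its sorted mode x = ψ_k to an earlier
-- position and keeps the relative order of all other modes. For p ≠ x this can
-- only remove x from f(ψ, p), so f(ψ', p) ⊆ f(ψ, p). Along a sequence avoiding
-- p = σ_i we get f(ψ, σ_i) ⊆ f(τ, σ_i), hence ψ ≠ σ.

module _ {A : Set} where

  data Follows (p q : A) : List A → Set where
    here  : ∀ {ys} → q ∈ ys → Follows p q (p ∷ ys)
    there : ∀ {y ys} → Follows p q ys → Follows p q (y ∷ ys)

  Follows-++ : ∀ {xs ys : List A} {p q : A} → q ∈ ys → Follows p q (xs ++ p ∷ ys)
  Follows-++ {[]}     q∈ys = here q∈ys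
  Follows-++ {x ∷ xs} q∈ys = there (Follows-++ {xs} q∈ys)

  ∈-move-right : ∀ {q : A} xs x ys zs → q ∈ xs ++ x ∷ ys ++ zs → q ∈ xs ++ ys ++ x ∷ zs
  ∈-move-right xs x ys zs = ∈-resp-↭ (++⁺ˡ xs (↭-sym (shift x ys zs)))

  Follows-insert : ∀ {p q : A} x ys zs → Follows p q (ys ++ zs) → Follows p q (ys ++ x ∷ zs)
  Follows-insert x []       zs h         = there h
  Follows-insert x (y ∷ ys) zs (here m)  = here (∈-move-right [] x ys zs (there m))
  Follows-insert x (y ∷ ys) zs (there h) = there (Follows-insert x ys zs h)

  Follows-move-right : ∀ {p q x : A} xs ys zs → x ≢ p →
                       Follows p q (xs ++ x ∷ ys ++ zs) → Follows p q (xs ++ ys ++ x ∷ zs)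
  Follows-move-right []       ys zs x≢p (here _)  = ⊥-elim (x≢p refl)
  Follows-move-right []       ys zs x≢p (there h) = Follows-insert _ ys zs h
  Follows-move-right (y ∷ xs) ys zs x≢p (here m)  = here (∈-move-right xs _ ys zs m)
  Follows-move-right (y ∷ xs) ys zs x≢p (there h) = there (Follows-move-right xs ys zs x≢p h)

module _ {r : ℕ} where

  Follows⇒f : ∀ {τ : Ordering r} {p q} → Follows p q τ → f τ p q
  Follows⇒f (here {ys} q∈ys) = [] , ys , refl , q∈ys
  Follows⇒f {y ∷ _} (there h) with Follows⇒f h
  ... | xs , ys , refl , q∈ys = y ∷ xs , ys , refl , q∈ys

  f⇒Follows : ∀ {τ : Ordering r} {p q} → f τ p q → Follows p q τ
  f⇒Follows (xs , ys , refl , q∈ys) = Follows-++ {xs = xs} q∈ys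

  -- The right-hand side is reorder ψ l j with the moved mode put back in place.
  reorder-split : (ψ : Ordering r) (l : ℕ) (j : Fin (length ψ)) → l ≤ toℕ j →
                  ψ ≡ take l ψ ++ take (toℕ j ∸ l) (drop l ψ) ++ lookup ψ j ∷ drop (suc (toℕ j)) ψ
  reorder-split (x ∷ ψ) zero    fzero    _        = refl
  reorder-split (x ∷ ψ) zero    (fsuc j) _        = cong (x ∷_) (reorder-split ψ zero j z≤n)
  reorder-split (x ∷ ψ) (suc l) (fsuc j) (s≤s l≤j) = cong (x ∷_) (reorder-split ψ l j l≤j)

  Step-reflects-Follows : ∀ {ψ ψ' : Ordering r} {x p q} → Step ψ x ψ' → x ≢ p →
                          Follows p q ψ' → Follows p q ψ
  Step-reflects-Follows {ψ} {p = p} {q} (partialSort l j l≤j) x≢p h =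
    subst (Follows p q) (sym (reorder-split ψ l j l≤j))
      (Follows-move-right (take l ψ) (take (toℕ j ∸ l) (drop l ψ)) (drop (suc (toℕ j)) ψ) x≢p h)

  Seq-reflects-f : ∀ {τ ψ : Ordering r} {ps p} → Seq τ ψ ps → All (_≢ p) ps → f ψ p ⊆ f τ p
  Seq-reflects-f done         []             q∈f = q∈f
  Seq-reflects-f (step s seq) (x≢p ∷ avoids) q∈f =
    Follows⇒f (Step-reflects-Follows s x≢p (f⇒Follows (Seq-reflects-f seq avoids q∈f)))

lemma3p2 : {r : ℕ} (n : Fin r → ℕ) (A : List (Coord n)) (τ σ : Ordering r) →
           Complete τ → Complete σ → Sorted n τ A →
           ((i : Fin (length σ)) → ¬ (f σ (lookup σ i) ⊆ f τ (lookup σ i)) →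
             (ψ : Ordering r) (ps : List (Fin r)) → Seq τ ψ ps →
             All (λ p → p ≢ lookup σ i) ps → ψ ≢ σ)
           × ((ps : List (Fin r)) → Seq τ σ ps →
             (i : Fin (length σ)) → ¬ (f σ (lookup σ i) ⊆ f τ (lookup σ i)) →
             lookup σ i ∈ ps)
lemma3p2 n A τ σ _ _ _ = unreachable , mustSort
  where
  unreachable : (i : Fin (length σ)) → ¬ (f σ (lookup σ i) ⊆ f τ (lookup σ i)) →
                (ψ : Ordering _) (ps : List (Fin _)) → Seq τ ψ ps →
                All (λ p → p ≢ lookup σ i) ps → ψ ≢ σ
  unreachable i f⊈f ψ ps seq avoids refl = f⊈f (Seq-reflects-f seq avoids)

  mustSort : (ps : List (Fin _)) → Seq τ σ ps →
             (i : Fin (length σ)) → ¬ (f σ (lookup σ i) ⊆ f τ (lookup σ i)) →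
             lookup σ i ∈ ps
  mustSort ps seq i f⊈f with any? (lookup σ i ≟_) ps
  ... | yes σᵢ∈ps = σᵢ∈ps
  ... | no  σᵢ∉ps =
    ⊥-elim (unreachable i f⊈f σ ps seq (All.map ≢-sym (¬Any⇒All¬ ps σᵢ∉ps)) refl)
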